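{- Let $m\ge3$ be odd and $n\ge1$, and let $\tau^{(n)}$ be as defined in the context. Then $\tau^{(n)}$ is an embedding of $S(n,m)$ into the Hamming graph $K_m^n$ (so its image $T(n,m)$ is a subgraph of $K_m^n$ isomorphic to $S(n,m)$), and $\tau^{(n)}(i^n)=i^n$ for every $i\in\{0,\dots,m-1\}$, where $i^n=(i,\dots,i)$.
   Context: For $n\ge1$, $m\ge2$, the Sierpinski graph $S(n,m)$ has vertex set $\{0,1,\dots,m-1\}^n$, and two distinct vertices $u,v$ are adjacent iff there exists $h\in\{1,\dots,n\}$ such that: $u_i=v_i$ for $i<h$; $u_h\neq v_h$; and $u_j=v_h$, $v_j=u_h$ for all $j>h$. The Hamming graph $K_m^n$ has vertex set $\{0,\dots,m-1\}^n$, two vertices adjacent iff they differ in exactly one coordinate. An embedding is an injective vertex map sending edges to edges. For odd $m$ let $c=2^{ -1}\bmod m=(m+1)/2$ and define $\tau^{(n)}:\{0,\dots,m-1\}^n\to\{0,\dots,m-1\}^n$ recursively by $\tau^{(1)}=$ identity and, for $n\ge2$, $\tau^{(n)}(v_1,\dots,v_n)=\bigl(v_1,\ \tau^{(n-1)}(c(v_1+v_2)\bmod m,\dots,c(v_1+v_n)\bmod m)\bigr)$. -}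

module Defs where

open import Data.Nat using (ℕ; zero; suc; _+_; _*_; _/_; _<_; NonZero)
open import Data.Nat.DivMod using (_mod_)
open import Data.Fin using (Fin; toℕ; _<_)
open import Data.Vec using (Vec; []; _∷_; map; lookup; replicate)
open import Data.Product using (Σ; _×_; ∃-syntax)
open import Relation.Binary.PropositionalEquality using (_≡_)
open import Relation.Nullary using (¬_)
open import Data.Empty using (⊥)
open import Data.Unit using (⊤)
open import Data.Sum using (_⊎_)

-- Vertices of S(n,m) and of K_m^n: words of length n over {0,…,m-1}.
Word : ℕ → ℕ → Set
Word m n = Vec (Fin m) n

SierpinskiAdj : ∀ {m n} → Word m n → Word m n → Set
SierpinskiAdj {m} {n} u v =
  ∃[ h ] ( (∀ (i : Fin n) → i Data.Fin.< h → lookup u i ≡ lookup v i)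
         × ¬ (lookup u h ≡ lookup v h)
         × (∀ (j : Fin n) → h Data.Fin.< j →
              (lookup u j ≡ lookup v h) × (lookup v j ≡ lookup u h)) )

HammingAdj : ∀ {m n} → Word m n → Word m n → Set
HammingAdj {m} {n} u v =
  ∃[ k ] ( ¬ (lookup u k ≡ lookup v k)
         × (∀ (i : Fin n) → ¬ (i ≡ k) → lookup u i ≡ lookup v i) )

IsEmbedding : ∀ {m n} → (Word m n → Word m n) → Set
IsEmbedding {m} {n} f =
  (∀ u v → f u ≡ f v → u ≡ v) × (∀ u v → SierpinskiAdj u v → HammingAdj (f u) (f v))

-- c = 2⁻¹ mod m = (m+1)/2 for odd m
half : ℕ → ℕ
half m = suc m / 2

step : ∀ m .{{_ : NonZero m}} → Fin m → Fin m → Fin m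
step m a x = (half m * (toℕ a + toℕ x)) mod m

tau : ∀ m .{{_ : NonZero m}} → ∀ n → Word m n → Word m n
tau m zero [] = []
tau m (suc zero) (v ∷ []) = v ∷ []
tau m (suc (suc n)) (v₁ ∷ vs) = v₁ ∷ tau m (suc n) (map (step m v₁) vs)

-- τ builds a word letter by letter: the first letter is kept and the remaining suffix is pushed
-- through x ↦ (v₁ + x)/2 mod m, a bijection of ℤ_m fixing v₁ (it is here that m must be odd).
-- A Sierpinski edge either shares its first letter, and then the recursion applies to the
-- suffixes (an injective letter map preserves Sierpinski edges), or it is an edge between the
-- words a bⁿ⁻¹ and b aⁿ⁻¹; these are sent to a cⁿ⁻¹ and b cⁿ⁻¹ with c = (a + b)/2, because
-- τ fixes constant words, so they differ in the first letter only.
module Submission where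

open import Defs
open import Data.Nat using (ℕ; zero; suc; _+_; _*_; _∸_; _≤_; _%_; _/_; NonZero; z≤n; s≤s)
open import Data.Nat.Properties using (*-assoc; *-comm; +-comm; <⇒≤; m+[n∸m]≡n)
open import Data.Nat.DivMod using (_mod_; m≡m%n+[m/n]*n; m*n/n≡m; [m+n]%n≡m%n; [m+kn]%n≡m%n; m<n⇒m%n≡m; m%n<n)
open import Data.Nat.Tactic.RingSolver using (solve-∀)
open import Data.Fin using (Fin; zero; suc; toℕ)
open import Data.Fin.Properties using (toℕ-injective; toℕ-fromℕ<; toℕ<n)
open import Data.Vec using (Vec; []; _∷_; map; lookup; replicate)
open import Data.Vec.Properties using (lookup-map; map-replicate; ∷-injective)
open import Data.Product using (_×_; _,_; proj₁; proj₂)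
open import Data.Sum using (_⊎_; inj₁; inj₂)
open import Data.Empty using (⊥-elim)
open import Function using (_∘_)
open import Function.Definitions using (Injective)
open import Relation.Binary.PropositionalEquality
  using (_≡_; _≢_; refl; sym; trans; cong; cong₂; module ≡-Reasoning)

open ≡-Reasoning

[k*[n%d]+r]%d≡[k*n+r]%d : ∀ k n r d .{{_ : NonZero d}} → (k * (n % d) + r) % d ≡ (k * n + r) % d
[k*[n%d]+r]%d≡[k*n+r]%d k n r d = begin
  (k * (n % d) + r) % d                     ≡⟨ sym ([m+kn]%n≡m%n _ (k * (n / d)) d) ⟩
  (k * (n % d) + r + k * (n / d) * d) % d   ≡⟨ cong (_% d) (regroup k (n % d) r (n / d) d) ⟩
  (k * (n % d + n / d * d) + r) % d         ≡⟨ cong (λ t → (k * t + r) % d) (sym (m≡m%n+[m/n]*n n d)) ⟩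
  (k * n + r) % d                           ∎
  where
  regroup : ∀ k p r q d → k * p + r + k * q * d ≡ k * (p + q * d) + r
  regroup = solve-∀

odd⇒2*half≡1+m : ∀ m → m % 2 ≡ 1 → 2 * half m ≡ suc m
odd⇒2*half≡1+m m m-odd = begin
  2 * (suc m / 2)        ≡⟨ cong (λ t → 2 * (t / 2)) 1+m≡[1+m/2]*2 ⟩
  2 * (suc k * 2 / 2)    ≡⟨ cong (2 *_) (m*n/n≡m (suc k) 2) ⟩
  2 * suc k              ≡⟨ *-comm 2 (suc k) ⟩
  suc k * 2              ≡⟨ sym 1+m≡[1+m/2]*2 ⟩
  suc m                  ∎
  where
  k = m / 2
  1+m≡[1+m/2]*2 : suc m ≡ suc k * 2
  1+m≡[1+m/2]*2 = cong suc (trans (m≡m%n+[m/n]*n m 2) (cong (_+ k * 2) m-odd))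

map-injective : ∀ {A B : Set} {n} {f : A → B} → Injective _≡_ _≡_ f → Injective _≡_ _≡_ (map {n = n} f)
map-injective f-inj {[]}     {[]}     _  = refl
map-injective f-inj {x ∷ xs} {y ∷ ys} eq =
  let fx≡fy , fxs≡fys = ∷-injective eq in cong₂ _∷_ (f-inj fx≡fy) (map-injective f-inj fxs≡fys)

lookup-const⇒replicate : ∀ {A : Set} {n} (xs : Vec A n) {b} → (∀ j → lookup xs j ≡ b) → xs ≡ replicate n b
lookup-const⇒replicate []       _      = refl
lookup-const⇒replicate (x ∷ xs) xs≡b = cong₂ _∷_ (xs≡b zero) (lookup-const⇒replicate xs (xs≡b ∘ suc))

map-preserves-SierpinskiAdj : ∀ {m n} {f : Fin m → Fin m} → Injective _≡_ _≡_ f →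
  ∀ {u v : Word m n} → SierpinskiAdj u v → SierpinskiAdj (map f u) (map f v)
map-preserves-SierpinskiAdj {f = f} f-inj {u} {v} (h , prefix , uₕ≢vₕ , suffix) =
  h , (λ i i<h → mapped-≡ u v i i (prefix i i<h))
    , (λ eq → uₕ≢vₕ (f-inj (trans (sym (lookup-map h f u)) (trans eq (lookup-map h f v)))))
    , (λ j h<j → mapped-≡ u v j h (proj₁ (suffix j h<j)) , mapped-≡ v u j h (proj₂ (suffix j h<j)))
  where
  mapped-≡ : ∀ (w w′ : Word _ _) i j → lookup w i ≡ lookup w′ j → lookup (map f w) i ≡ lookup (map f w′) j
  mapped-≡ w w′ i j eq = trans (lookup-map i f w) (trans (cong f eq) (sym (lookup-map j f w′)))

SierpinskiAdj-∷⁻ : ∀ {m n} {a b : Fin m} {us vs : Word m n} → SierpinskiAdj (a ∷ us) (b ∷ vs) →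
  (a ≢ b × us ≡ replicate n b × vs ≡ replicate n a) ⊎ (a ≡ b × SierpinskiAdj us vs)
SierpinskiAdj-∷⁻ {us = us} {vs} (zero , _ , a≢b , suffix) =
  inj₁ ( a≢b
       , lookup-const⇒replicate us (λ j → proj₁ (suffix (suc j) (s≤s z≤n)))
       , lookup-const⇒replicate vs (λ j → proj₂ (suffix (suc j) (s≤s z≤n))) )
SierpinskiAdj-∷⁻ (suc h , prefix , uₕ≢vₕ , suffix) =
  inj₂ ( prefix zero (s≤s z≤n)
       , h , (λ i i<h → prefix (suc i) (s≤s i<h)) , uₕ≢vₕ , (λ j h<j → suffix (suc j) (s≤s h<j)) )

HammingAdj-head : ∀ {m n} {a b : Fin m} {ws : Word m n} → a ≢ b → HammingAdj (a ∷ ws) (b ∷ ws)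
HammingAdj-head a≢b = zero , a≢b , λ { zero 0≢0 → ⊥-elim (0≢0 refl) ; (suc i) _ → refl }

HammingAdj-∷ : ∀ {m n} {a : Fin m} {us vs : Word m n} → HammingAdj us vs → HammingAdj (a ∷ us) (a ∷ vs)
HammingAdj-∷ (k , uₖ≢vₖ , rest) = suc k , uₖ≢vₖ , λ { zero _ → refl ; (suc i) i≢k → rest i (i≢k ∘ cong suc) }

tau-∷ : ∀ m .{{_ : NonZero m}} n (v : Fin m) (vs : Word m n) →
  tau m (suc n) (v ∷ vs) ≡ v ∷ tau m n (map (step m v) vs)
tau-∷ m zero    v [] = refl
tau-∷ m (suc n) v vs = refl

module OddModulus {m : ℕ} .{{_ : NonZero m}} (2*half≡1+m : 2 * half m ≡ suc m) where

  2*[half*n]≡[1+m]*n : ∀ n → 2 * (half m * n) ≡ suc m * n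
  2*[half*n]≡[1+m]*n n = trans (sym (*-assoc 2 (half m) n)) (cong (_* n) 2*half≡1+m)

  toℕ-step : ∀ a x → toℕ (step m a x) ≡ (half m * (toℕ a + toℕ x)) % m
  toℕ-step a x = toℕ-fromℕ< (m%n<n _ m)

  -- y ↦ 2y − a, with the subtraction made nonnegative by adding m.
  step⁻¹ : Fin m → Fin m → Fin m
  step⁻¹ a y = (2 * toℕ y + (m ∸ toℕ a)) mod m

  step⁻¹-step : ∀ a x → step⁻¹ a (step m a x) ≡ x
  step⁻¹-step a x = toℕ-injective (begin
    toℕ (step⁻¹ a (step m a x))                ≡⟨ toℕ-fromℕ< (m%n<n _ m) ⟩
    (2 * toℕ (step m a x) + d) % m             ≡⟨ cong (λ t → (2 * t + d) % m) (toℕ-step a x) ⟩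
    (2 * ((half m * s) % m) + d) % m           ≡⟨ [k*[n%d]+r]%d≡[k*n+r]%d 2 (half m * s) d m ⟩
    (2 * (half m * s) + d) % m                 ≡⟨ cong (λ t → (t + d) % m) (2*[half*n]≡[1+m]*n s) ⟩
    (suc m * s + d) % m                        ≡⟨ cong (_% m) (regroup m (toℕ a) (toℕ x) d) ⟩
    (toℕ x + (toℕ a + d) + s * m) % m          ≡⟨ [m+kn]%n≡m%n _ s m ⟩
    (toℕ x + (toℕ a + d)) % m                  ≡⟨ cong (λ t → (toℕ x + t) % m) (m+[n∸m]≡n (<⇒≤ (toℕ<n a))) ⟩
    (toℕ x + m) % m                            ≡⟨ [m+n]%n≡m%n (toℕ x) m ⟩
    toℕ x % m                                  ≡⟨ m<n⇒m%n≡m (toℕ<n x) ⟩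
    toℕ x                                      ∎)
    where
    s = toℕ a + toℕ x
    d = m ∸ toℕ a
    regroup : ∀ m a x d → suc m * (a + x) + d ≡ x + (a + d) + (a + x) * m
    regroup = solve-∀

  step-injective : ∀ a → Injective _≡_ _≡_ (step m a)
  step-injective a {x} {y} eq = begin
    x                      ≡⟨ sym (step⁻¹-step a x) ⟩
    step⁻¹ a (step m a x)  ≡⟨ cong (step⁻¹ a) eq ⟩
    step⁻¹ a (step m a y)  ≡⟨ step⁻¹-step a y ⟩
    y                      ∎

  step-comm : ∀ a b → step m a b ≡ step m b a
  step-comm a b = toℕ-injective (begin
    toℕ (step m a b)                    ≡⟨ toℕ-step a b ⟩
    (half m * (toℕ a + toℕ b)) % m      ≡⟨ cong (λ t → (half m * t) % m) (+-comm (toℕ a) (toℕ b)) ⟩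
    (half m * (toℕ b + toℕ a)) % m      ≡⟨ sym (toℕ-step b a) ⟩
    toℕ (step m b a)                    ∎)

  step-idem : ∀ a → step m a a ≡ a
  step-idem a = toℕ-injective (begin
    toℕ (step m a a)                     ≡⟨ toℕ-step a a ⟩
    (half m * (toℕ a + toℕ a)) % m       ≡⟨ cong (_% m) (halve-double (toℕ a)) ⟩
    (toℕ a + toℕ a * m) % m              ≡⟨ [m+kn]%n≡m%n (toℕ a) (toℕ a) m ⟩
    toℕ a % m                            ≡⟨ m<n⇒m%n≡m (toℕ<n a) ⟩
    toℕ a                                ∎)
    where
    regroup : ∀ c t → c * (t + t) ≡ 2 * (c * t)
    regroup = solve-∀
    halve-double : ∀ t → half m * (t + t) ≡ t + t * m
    halve-double t = begin
      half m * (t + t)   ≡⟨ regroup (half m) t ⟩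
      2 * (half m * t)   ≡⟨ 2*[half*n]≡[1+m]*n t ⟩
      suc m * t          ≡⟨ cong (t +_) (*-comm m t) ⟩
      t + t * m          ∎

  tau-replicate : ∀ n i → tau m n (replicate n i) ≡ replicate n i

  tau-∷-replicate : ∀ n a b → tau m (suc n) (a ∷ replicate n b) ≡ a ∷ replicate n (step m a b)
  tau-∷-replicate n a b = begin
    tau m (suc n) (a ∷ replicate n b)            ≡⟨ tau-∷ m n a _ ⟩
    a ∷ tau m n (map (step m a) (replicate n b)) ≡⟨ cong (λ w → a ∷ tau m n w) (map-replicate (step m a) b n) ⟩
    a ∷ tau m n (replicate n (step m a b))       ≡⟨ cong (a ∷_) (tau-replicate n _) ⟩
    a ∷ replicate n (step m a b)                 ∎

  tau-replicate zero    i = refl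
  tau-replicate (suc n) i =
    trans (tau-∷-replicate n i i) (cong (λ c → i ∷ replicate n c) (step-idem i))

  tau-injective : ∀ n → Injective _≡_ _≡_ (tau m n)
  tau-injective zero    {[]}     {[]}     _  = refl
  tau-injective (suc n) {a ∷ us} {b ∷ vs} eq
    with refl , tails≡ ← ∷-injective (trans (sym (tau-∷ m n a us)) (trans eq (tau-∷ m n b vs)))
    = cong (a ∷_) (map-injective (step-injective a) (tau-injective n tails≡))

  tau-preserves-adjacency : ∀ n {u v : Word m n} → SierpinskiAdj u v → HammingAdj (tau m n u) (tau m n v)
  tau-preserves-adjacency zero (() , _)
  tau-preserves-adjacency (suc n) {a ∷ us} {b ∷ vs} adj with SierpinskiAdj-∷⁻ adj
  ... | inj₁ (a≢b , refl , refl)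
    rewrite tau-∷-replicate n a b | tau-∷-replicate n b a | step-comm b a
    = HammingAdj-head a≢b
  ... | inj₂ (refl , adj′)
    rewrite tau-∷ m n a us | tau-∷ m n a vs
    = HammingAdj-∷ (tau-preserves-adjacency n
        (map-preserves-SierpinskiAdj (step-injective a) {us} {vs} adj′))

mainTheorem14 : ∀ (m : ℕ) .{{_ : NonZero m}} → 3 ≤ m → m % 2 ≡ 1 → ∀ (n : ℕ) → 1 ≤ n →
    IsEmbedding (tau m n) × (∀ (i : Fin m) → tau m n (replicate n i) ≡ replicate n i)
mainTheorem14 m _ m-odd n _ =
  ((λ _ _ → tau-injective n) , (λ _ _ → tau-preserves-adjacency n)) , tau-replicate n
  where open OddModulus (odd⇒2*half≡1+m m m-odd)
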